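{- For all $c_0,c_\infty\in\mathbb{C}$, all $n\ge0$ and $0\le k\le n$: (i) $E_{n,k}(0,0;c_0,c_\infty)=\binom nk c_0^{\,n-k}c_\infty^{\,k}$; (ii) $E_{n,k}(-1,1;c_0,c_\infty)=\binom nk(c_0+k)^{\overline{n-k}}(c_\infty)^{\underline k}$; (iii) for all $a,b\in\mathbb{C}$, $E_{n,k}(a,b;c_0,-c_0)=(-1)^k\binom nk(c_0)^{\underline n,a}$.
   Context: For complex parameters $(\alpha,\beta,\gamma;\alpha',\beta',\gamma')$, the GKP triangle is the unique array $T_{n,k}$, $0\le k\le n$ ($T_{n,k}=0$ if $k<0$ or $k>n$), with $T_{0,0}=1$ and $T_{n+1,k+1}=[\alpha n+\beta(k+1)+\gamma]T_{n,k+1}+[\alpha' n+\beta' k+\gamma']T_{n,k}$ for $n\ge0$, $k\ge-1$. The generalized Eulerian numbers $E_{n,k}(a,b;c_0,c_\infty)$ form the GKP triangle with parameters $(-a,b,c_0;\,a+b,-b,c_\infty)$. $x^{\overline m}=x(x+1)\cdots(x+m-1)$, $x^{\underline m}=x(x-1)\cdots(x-m+1)$, $(x)^{\underline m,a}=x(x-a)\cdots(x-(m-1)a)$, all equal to $1$ for $m=0$. -}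

module Defs where

open import Level using (Level)
open import Algebra.Bundles using (CommutativeRing)
open import Data.Nat as ℕ using (ℕ; zero; suc)
open import Data.Nat.Combinatorics using (_C_)

module GKPDefs {c ℓ : Level} (R : CommutativeRing c ℓ) where
  open CommutativeRing R hiding (zero)

  fromℕ : ℕ → Carrier
  fromℕ zero    = 0#
  fromℕ (suc n) = 1# + fromℕ n

  pow : Carrier → ℕ → Carrier
  pow x zero    = 1#
  pow x (suc m) = pow x m * x

  rise : Carrier → ℕ → Carrier
  rise x zero    = 1#
  rise x (suc m) = rise x m * (x + fromℕ m)

  fall : Carrier → ℕ → Carrier
  fall x zero    = 1#
  fall x (suc m) = fall x m * (x - fromℕ m)

  gfall : Carrier → ℕ → Carrier → Carrier
  gfall x zero    a = 1#
  gfall x (suc m) a = gfall x m a * (x - fromℕ m * a)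

  -- GKP triangle with parameters (α,β,γ;α',β',γ'); T n k for k : ℕ,
  -- with T_{n,-1} = 0 built in (the k = -1 case of the recurrence is the
  -- clause for T (suc n) zero) and T_{0,k} = 0 for k > 0.
  GKP : (α β γ α' β' γ' : Carrier) → ℕ → ℕ → Carrier
  GKP α β γ α' β' γ' zero    zero    = 1#
  GKP α β γ α' β' γ' zero    (suc k) = 0#
  GKP α β γ α' β' γ' (suc n) zero    =
    (α * fromℕ n + γ) * GKP α β γ α' β' γ' n zero
  GKP α β γ α' β' γ' (suc n) (suc k) =
    (α * fromℕ n + β * fromℕ (suc k) + γ) * GKP α β γ α' β' γ' n (suc k)
    + (α' * fromℕ n + β' * fromℕ k + γ') * GKP α β γ α' β' γ' n k

  E : (a b c0 c∞ : Carrier) → ℕ → ℕ → Carrier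
  E a b c0 c∞ = GKP (- a) b c0 (a + b) (- b) c∞

  binom : ℕ → ℕ → Carrier
  binom n k = fromℕ (n C k)

{-# OPTIONS --safe #-}

-- A GKP triangle is determined by its recurrence, so each closed form is verified by
-- checking that it satisfies the recurrence. In the interior this reduces, after Pascal's
-- rule, to a polynomial identity which for (ii) and (iii) holds only modulo the
-- absorption identity (k+1) C(n,k+1) + k C(n,k) = n C(n,k).
module Submission where

open import Defs
open import Algebra.Bundles using (CommutativeRing; RawRing)
open import Data.Nat using (ℕ; _≤_; _∸_; zero; suc; _<_; s≤s)
open import Data.Product using (_×_; _,_)

open import Data.Maybe using (Maybe; just; nothing)
import Data.Nat as Nat
import Data.Nat.Properties as ℕₚ
open import Data.Nat.Combinatorics using (_C_; nCk+nC[k+1]≡[n+1]C[k+1]; nCn≡1; nC1≡n)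
open import Data.Nat.Tactic.RingSolver using (solve-∀)
open import Data.Product.Properties using (≡-dec)
open import Level using (0ℓ)
open import Relation.Binary.PropositionalEquality as ≡ using (_≡_; cong)
open import Relation.Nullary using (yes; no)
import Algebra.Solver.Ring.AlmostCommutativeRing as ACR

module BinomialCoefficients where
  open import Data.Nat using (_+_; _*_)
  open ≡.≡-Reasoning

  nCk-absorption : ∀ n k → suc k * (n C suc k) + k * (n C k) ≡ n * (n C k)
  nCk-absorption zero    zero    = ≡.refl
  nCk-absorption zero    (suc k) = ≡.cong₂ _+_ (ℕₚ.*-zeroʳ (suc (suc k))) (ℕₚ.*-zeroʳ (suc k))
  nCk-absorption (suc n) zero    = begin
    1 * (suc n C 1) + 0  ≡⟨ ℕₚ.+-identityʳ _ ⟩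
    1 * (suc n C 1)      ≡⟨ ℕₚ.*-identityˡ _ ⟩
    suc n C 1            ≡⟨ nC1≡n (suc n) ⟩
    suc n                ≡⟨ ℕₚ.*-identityʳ (suc n) ⟨
    suc n * 1            ∎
  nCk-absorption (suc n) (suc k) = begin
    suc (suc k) * (suc n C suc (suc k)) + suc k * (suc n C suc k)
      ≡⟨ ≡.cong₂ (λ x y → suc (suc k) * x + suc k * y)
                 (≡.sym (nCk+nC[k+1]≡[n+1]C[k+1] n (suc k))) (≡.sym (nCk+nC[k+1]≡[n+1]C[k+1] n k)) ⟩
    suc (suc k) * (b + c) + suc k * (a + b)
      ≡⟨ regroup k a b c ⟩
    (suc (suc k) * c + suc k * b) + b + ((suc k * b + k * a) + a)
      ≡⟨ ≡.cong₂ (λ x y → x + b + (y + a)) (nCk-absorption n (suc k)) (nCk-absorption n k) ⟩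
    n * b + b + (n * a + a)
      ≡⟨ collect n a b ⟩
    suc n * (a + b)
      ≡⟨ cong (suc n *_) (nCk+nC[k+1]≡[n+1]C[k+1] n k) ⟩
    suc n * (suc n C suc k) ∎
    where
    a = n C k
    b = n C suc k
    c = n C suc (suc k)
    regroup : ∀ k a b c → suc (suc k) * (b + c) + suc k * (a + b)
                        ≡ (suc (suc k) * c + suc k * b) + b + ((suc k * b + k * a) + a)
    regroup = solve-∀
    collect : ∀ n a b → n * b + b + (n * a + a) ≡ suc n * (a + b)
    collect = solve-∀

open BinomialCoefficients using (nCk-absorption)

-- (a , b) codes the integer a - b. The operations normalise their result to have a zero
-- component, so equal integers have equal codes and coefficient equality is decided
-- syntactically (coeff≟ below).
module IntegerPairs where
  open import Data.Nat using (_+_; _*_)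

  normalise : ℕ × ℕ → ℕ × ℕ
  normalise (a , b) = a ∸ b , b ∸ a

  normalise-balanced : ∀ a b → (a ∸ b) + b ≡ (b ∸ a) + a
  normalise-balanced zero    zero    = ≡.refl
  normalise-balanced zero    (suc b) = ≡.sym (ℕₚ.+-identityʳ (suc b))
  normalise-balanced (suc a) zero    = ℕₚ.+-identityʳ (suc a)
  normalise-balanced (suc a) (suc b) = begin
    (a ∸ b) + suc b  ≡⟨ ℕₚ.+-suc (a ∸ b) b ⟩
    suc (a ∸ b + b)  ≡⟨ cong suc (normalise-balanced a b) ⟩
    suc (b ∸ a + a)  ≡⟨ ℕₚ.+-suc (b ∸ a) a ⟨
    (b ∸ a) + suc a  ∎
    where open ≡.≡-Reasoning

  rawRing : RawRing 0ℓ 0ℓ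
  rawRing = record
    { Carrier = ℕ × ℕ
    ; _≈_     = _≡_
    ; _+_     = λ { (a , b) (c , d) → normalise (a + c , b + d) }
    ; _*_     = λ { (a , b) (c , d) → normalise (a * c + b * d , a * d + b * c) }
    ; -_      = λ { (a , b) → b , a }
    ; 0#      = 0 , 0
    ; 1#      = 1 , 0
    }

module _ {c ℓ} (R : CommutativeRing c ℓ) where
  open CommutativeRing R hiding (zero)
  open GKPDefs R
  open import Algebra.Properties.Ring ring using (x[y-z]≈xy-xz; [y-z]x≈yx-zx)
  open import Algebra.Properties.AbelianGroup +-abelianGroup using (⁻¹-anti-homo‿-; ⁻¹-∙-comm)
  open import Algebra.Properties.CommutativeSemigroup +-commutativeSemigroup using (interchange)
  open import Algebra.Properties.Group +-group using (x∙y⁻¹≈ε⇒x≈y; x≈y⇒x∙y⁻¹≈ε; ε⁻¹≈ε)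
  open import Relation.Binary.Reasoning.Setoid setoid

  fromℕ-+ : ∀ m n → fromℕ (m Nat.+ n) ≈ fromℕ m + fromℕ n
  fromℕ-+ zero    n = sym (+-identityˡ _)
  fromℕ-+ (suc m) n = trans (+-congˡ (fromℕ-+ m n)) (sym (+-assoc _ _ _))

  fromℕ-* : ∀ m n → fromℕ (m Nat.* n) ≈ fromℕ m * fromℕ n
  fromℕ-* zero    n = sym (zeroˡ _)
  fromℕ-* (suc m) n = begin
    fromℕ (n Nat.+ m Nat.* n)        ≈⟨ fromℕ-+ n (m Nat.* n) ⟩
    fromℕ n + fromℕ (m Nat.* n)    ≈⟨ +-cong (sym (*-identityˡ _)) (fromℕ-* m n) ⟩
    1# * fromℕ n + fromℕ m * fromℕ n  ≈⟨ distribʳ _ _ _ ⟨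
    (1# + fromℕ m) * fromℕ n     ∎

  [x+z]-[y+w]≈[x-y]+[z-w] : ∀ x y z w → (x + z) - (y + w) ≈ (x - y) + (z - w)
  [x+z]-[y+w]≈[x-y]+[z-w] x y z w = begin
    (x + z) - (y + w)      ≈⟨ +-congˡ (⁻¹-∙-comm y w) ⟨
    (x + z) + (- y + - w)  ≈⟨ interchange x z (- y) (- w) ⟩
    (x - y) + (z - w)      ∎

  [xz+yw]-[xw+yz]≈[x-y][z-w] : ∀ x y z w → (x * z + y * w) - (x * w + y * z) ≈ (x - y) * (z - w)
  [xz+yw]-[xw+yz]≈[x-y][z-w] x y z w = begin
    (x * z + y * w) - (x * w + y * z)        ≈⟨ [x+z]-[y+w]≈[x-y]+[z-w] _ _ _ _ ⟩
    (x * z - x * w) + (y * w - y * z)        ≈⟨ +-congˡ (⁻¹-anti-homo‿- _ _) ⟨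
    (x * z - x * w) - (y * z - y * w)        ≈⟨ +-cong (x[y-z]≈xy-xz x z w) (-‿cong (x[y-z]≈xy-xz y z w)) ⟨
    x * (z - w) - y * (z - w)                ≈⟨ [y-z]x≈yx-zx (z - w) x y ⟨
    (x - y) * (z - w)                        ∎

  x+w≈y+z⇒x-y≈z-w : ∀ {x y z w} → x + w ≈ y + z → x - y ≈ z - w
  x+w≈y+z⇒x-y≈z-w {x} {y} {z} {w} eq = x∙y⁻¹≈ε⇒x≈y _ _ (begin
    (x - y) - (z - w)   ≈⟨ +-congˡ (⁻¹-anti-homo‿- z w) ⟩
    (x - y) + (w - z)   ≈⟨ [x+z]-[y+w]≈[x-y]+[z-w] x y w z ⟨
    (x + w) - (y + z)   ≈⟨ +-congʳ eq ⟩
    (y + z) - (y + z)   ≈⟨ -‿inverseʳ _ ⟩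
    0#                  ∎)

  open IntegerPairs using (normalise; normalise-balanced)

  -- 0, 1 and -1 decode to the ring's own constants, so that the literals 0#, 1# and - 1#
  -- occurring in goals are matched by con.
  coeff : ℕ × ℕ → Carrier
  coeff (0 , 0) = 0#
  coeff (1 , 0) = 1#
  coeff (0 , 1) = - 1#
  coeff (a , b) = fromℕ a - fromℕ b

  coeff-correct : ∀ a b → coeff (a , b) ≈ fromℕ a - fromℕ b
  coeff-correct 0 0 = sym (-‿inverseʳ 0#)
  coeff-correct 1 0 = sym (trans (+-congˡ ε⁻¹≈ε) (trans (+-identityʳ _) (+-identityʳ 1#)))
  coeff-correct 0 1 = sym (trans (+-identityˡ _) (-‿cong (+-identityʳ 1#)))
  coeff-correct 0 (suc (suc b)) = refl
  coeff-correct 1 (suc b) = refl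
  coeff-correct (suc (suc a)) b = refl

  coeff-normalise : ∀ a b → coeff (normalise (a , b)) ≈ fromℕ a - fromℕ b
  coeff-normalise a b = trans (coeff-correct (a ∸ b) (b ∸ a)) (x+w≈y+z⇒x-y≈z-w (begin
    fromℕ (a ∸ b) + fromℕ b       ≈⟨ fromℕ-+ (a ∸ b) b ⟨
    fromℕ (a ∸ b Nat.+ b)         ≡⟨ cong fromℕ (normalise-balanced a b) ⟩
    fromℕ (b ∸ a Nat.+ a)         ≈⟨ fromℕ-+ (b ∸ a) a ⟩
    fromℕ (b ∸ a) + fromℕ a       ∎))

  coeff-+ : ∀ a b c d → coeff (normalise (a Nat.+ c , b Nat.+ d)) ≈ coeff (a , b) + coeff (c , d)
  coeff-+ a b c d = begin
    coeff (normalise (a Nat.+ c , b Nat.+ d))            ≈⟨ coeff-normalise (a Nat.+ c) (b Nat.+ d) ⟩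
    fromℕ (a Nat.+ c) - fromℕ (b Nat.+ d)                ≈⟨ +-cong (fromℕ-+ a c) (-‿cong (fromℕ-+ b d)) ⟩
    (fromℕ a + fromℕ c) - (fromℕ b + fromℕ d)            ≈⟨ [x+z]-[y+w]≈[x-y]+[z-w] _ _ _ _ ⟩
    (fromℕ a - fromℕ b) + (fromℕ c - fromℕ d)            ≈⟨ +-cong (coeff-correct a b) (coeff-correct c d) ⟨
    coeff (a , b) + coeff (c , d)                        ∎

  coeff-* : ∀ a b c d → coeff (normalise (a Nat.* c Nat.+ b Nat.* d , a Nat.* d Nat.+ b Nat.* c))
                        ≈ coeff (a , b) * coeff (c , d)
  coeff-* a b c d = begin
    coeff (normalise (a Nat.* c Nat.+ b Nat.* d , a Nat.* d Nat.+ b Nat.* c))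
      ≈⟨ coeff-normalise (a Nat.* c Nat.+ b Nat.* d) (a Nat.* d Nat.+ b Nat.* c) ⟩
    fromℕ (a Nat.* c Nat.+ b Nat.* d) - fromℕ (a Nat.* d Nat.+ b Nat.* c)
      ≈⟨ +-cong (sum-of-products a c b d) (-‿cong (sum-of-products a d b c)) ⟩
    (fromℕ a * fromℕ c + fromℕ b * fromℕ d) - (fromℕ a * fromℕ d + fromℕ b * fromℕ c)
      ≈⟨ [xz+yw]-[xw+yz]≈[x-y][z-w] _ _ _ _ ⟩
    (fromℕ a - fromℕ b) * (fromℕ c - fromℕ d)
      ≈⟨ *-cong (coeff-correct a b) (coeff-correct c d) ⟨
    coeff (a , b) * coeff (c , d)
      ∎
    where
    sum-of-products : ∀ w x y z → fromℕ (w Nat.* x Nat.+ y Nat.* z) ≈ fromℕ w * fromℕ x + fromℕ y * fromℕ z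
    sum-of-products w x y z = trans (fromℕ-+ (w Nat.* x) (y Nat.* z)) (+-cong (fromℕ-* w x) (fromℕ-* y z))

  coeff-neg : ∀ a b → coeff (b , a) ≈ - coeff (a , b)
  coeff-neg a b = begin
    coeff (b , a)          ≈⟨ coeff-correct b a ⟩
    fromℕ b - fromℕ a      ≈⟨ ⁻¹-anti-homo‿- (fromℕ a) (fromℕ b) ⟨
    - (fromℕ a - fromℕ b)  ≈⟨ -‿cong (coeff-correct a b) ⟨
    - coeff (a , b)        ∎

  coeff-morphism : IntegerPairs.rawRing ACR.-Raw-AlmostCommutative⟶ ACR.fromCommutativeRing R
  coeff-morphism = record
    { ⟦_⟧    = coeff
    ; +-homo = λ { (a , b) (c , d) → coeff-+ a b c d }
    ; *-homo = λ { (a , b) (c , d) → coeff-* a b c d }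
    ; -‿homo = λ { (a , b) → coeff-neg a b }
    ; 0-homo = refl
    ; 1-homo = refl
    }

  coeff≟ : (p q : ℕ × ℕ) → Maybe (coeff p ≈ coeff q)
  coeff≟ p q with ≡-dec Nat._≟_ Nat._≟_ p q
  ... | yes ≡.refl = just refl
  ... | no _       = nothing

  open import Algebra.Solver.Ring IntegerPairs.rawRing (ACR.fromCommutativeRing R) coeff-morphism coeff≟

  :0 :1 : ∀ {n} → Polynomial n
  :0 = con (0 , 0)
  :1 = con (1 , 0)

  ≈-modulo : ∀ {x y z u v} → x ≈ y + z * (u - v) → u ≈ v → x ≈ y
  ≈-modulo {x} {y} {z} {u} {v} x≈y+z[u-v] u≈v = begin
    x               ≈⟨ x≈y+z[u-v] ⟩
    y + z * (u - v) ≈⟨ +-congˡ (*-congˡ (x≈y⇒x∙y⁻¹≈ε u≈v)) ⟩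
    y + z * 0#      ≈⟨ +-congˡ (zeroʳ z) ⟩
    y + 0#          ≈⟨ +-identityʳ y ⟩
    y               ∎

  binom-diagonal : ∀ n → binom n n ≈ 1#
  binom-diagonal n = trans (reflexive (cong fromℕ (nCn≡1 n))) (+-identityʳ 1#)

  binom-pascal : ∀ n k → binom (suc n) (suc k) ≈ binom n k + binom n (suc k)
  binom-pascal n k = begin
    fromℕ (suc n C suc k)                ≡⟨ cong fromℕ (nCk+nC[k+1]≡[n+1]C[k+1] n k) ⟨
    fromℕ (n C k Nat.+ n C suc k)        ≈⟨ fromℕ-+ (n C k) (n C suc k) ⟩
    binom n k + binom n (suc k)          ∎

  binom-absorption : ∀ n k → fromℕ (suc k) * binom n (suc k) + fromℕ k * binom n k ≈ fromℕ n * binom n k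
  binom-absorption n k = begin
    fromℕ (suc k) * binom n (suc k) + fromℕ k * binom n k
      ≈⟨ +-cong (fromℕ-* (suc k) (n C suc k)) (fromℕ-* k (n C k)) ⟨
    fromℕ (suc k Nat.* (n C suc k)) + fromℕ (k Nat.* (n C k))
      ≈⟨ fromℕ-+ (suc k Nat.* (n C suc k)) (k Nat.* (n C k)) ⟨
    fromℕ (suc k Nat.* (n C suc k) Nat.+ k Nat.* (n C k))
      ≡⟨ cong fromℕ (nCk-absorption n k) ⟩
    fromℕ (n Nat.* (n C k))
      ≈⟨ fromℕ-* n (n C k) ⟩
    fromℕ n * binom n k
      ∎

  rise-cong : ∀ {x y} m → x ≈ y → rise x m ≈ rise y m
  rise-cong zero    x≈y = refl
  rise-cong (suc m) x≈y = *-cong (rise-cong m x≈y) (+-congʳ x≈y)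

  rise-shift : ∀ x m → rise x (suc m) ≈ x * rise (x + 1#) m
  rise-shift x zero    = solve 1 (λ x → :1 :* (x :+ :0) := x :* :1) refl x
  rise-shift x (suc m) = trans (*-congʳ (rise-shift x m))
    (solve 3 (λ x r M → x :* r :* (x :+ (:1 :+ M)) := x :* (r :* (x :+ :1 :+ M))) refl x (rise (x + 1#) m) (fromℕ m))

  module _ (α β γ α' β' γ' : Carrier) where
    private
      T : ℕ → ℕ → Carrier
      T = GKP α β γ α' β' γ'

    GKP-above-diagonal : ∀ {n k} → n < k → T n k ≈ 0#
    GKP-above-diagonal {zero}  {suc k} _         = refl
    GKP-above-diagonal {suc n} {suc k} (s≤s n<k) =
      trans (+-cong (*-congˡ (GKP-above-diagonal (ℕₚ.m<n⇒m<1+n n<k))) (*-congˡ (GKP-above-diagonal n<k)))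
            (trans (+-cong (zeroʳ _) (zeroʳ _)) (+-identityʳ 0#))

    -- F n k m is the candidate value at (n , k), with m = n - k passed separately so that
    -- closed forms need not mention truncated subtraction.
    GKP-unique : (F : ℕ → ℕ → ℕ → Carrier) →
      F 0 0 0 ≈ 1# →
      (∀ m → F (suc m) 0 (suc m) ≈ (α * fromℕ m + γ) * F m 0 m) →
      (∀ k → F (suc k) (suc k) 0 ≈ (α' * fromℕ k + β' * fromℕ k + γ') * F k k 0) →
      (∀ k m → let n = k Nat.+ suc m in
        F (suc n) (suc k) (suc m) ≈ (α * fromℕ n + β * fromℕ (suc k) + γ) * F n (suc k) m
                                    + (α' * fromℕ n + β' * fromℕ k + γ') * F n k (suc m)) →
      ∀ {n k} → k ≤ n → T n k ≈ F n k (n ∸ k)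
    GKP-unique F init column diagonal interior {n} {k} k≤n =
      reindex (ℕₚ.m+[n∸m]≡n k≤n) (on-triangle k (n ∸ k))
      where
      reindex : ∀ {n n′ k m} → n ≡ n′ → T n k ≈ F n k m → T n′ k ≈ F n′ k m
      reindex ≡.refl T≈F = T≈F

      on-diagonal : ∀ k → T k k ≈ F k k 0
      on-diagonal zero    = sym init
      on-diagonal (suc k) = begin
        (α * fromℕ k + β * fromℕ (suc k) + γ) * T k (suc k) + (α' * fromℕ k + β' * fromℕ k + γ') * T k k
          ≈⟨ +-cong (*-congˡ (GKP-above-diagonal (ℕₚ.n<1+n k))) (*-congˡ (on-diagonal k)) ⟩
        (α * fromℕ k + β * fromℕ (suc k) + γ) * 0# + (α' * fromℕ k + β' * fromℕ k + γ') * F k k 0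
          ≈⟨ trans (+-congʳ (zeroʳ _)) (+-identityˡ _) ⟩
        (α' * fromℕ k + β' * fromℕ k + γ') * F k k 0
          ≈⟨ diagonal k ⟨
        F (suc k) (suc k) 0
          ∎

      on-triangle : ∀ k m → T (k Nat.+ m) k ≈ F (k Nat.+ m) k m
      on-triangle k       zero    = reindex (≡.sym (ℕₚ.+-identityʳ k)) (on-diagonal k)
      on-triangle zero    (suc m) = trans (*-congˡ (on-triangle 0 m)) (sym (column m))
      on-triangle (suc k) (suc m) =
        trans (+-cong (*-congˡ (reindex (≡.sym (ℕₚ.+-suc k m)) (on-triangle (suc k) m)))
                      (*-congˡ (on-triangle k (suc m))))
              (sym (interior k m))

  E[0,0]-closed-form : ∀ c0 c∞ {n k} → k ≤ n → E 0# 0# c0 c∞ n k ≈ binom n k * pow c0 (n ∸ k) * pow c∞ k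
  E[0,0]-closed-form c0 c∞ = GKP-unique (- 0#) 0# c0 (0# + 0#) (- 0#) c∞ F init column diagonal interior
    where
    F : ℕ → ℕ → ℕ → Carrier
    F n k m = binom n k * pow c0 m * pow c∞ k

    init : F 0 0 0 ≈ 1#
    init = solve 0 ((:1 :+ :0) :* :1 :* :1 := :1) refl

    column : ∀ m → F (suc m) 0 (suc m) ≈ (- 0# * fromℕ m + c0) * F m 0 m
    column m = solve 3 (λ c0 M p → (:1 :+ :0) :* (p :* c0) :* :1 := (:- :0 :* M :+ c0) :* ((:1 :+ :0) :* p :* :1))
                 refl c0 (fromℕ m) (pow c0 m)

    diagonal : ∀ k → F (suc k) (suc k) 0 ≈ ((0# + 0#) * fromℕ k + - 0# * fromℕ k + c∞) * F k k 0
    diagonal k = trans (*-congʳ (*-congʳ (trans (binom-diagonal (suc k)) (sym (binom-diagonal k)))))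
      (solve 4 (λ c∞ K q B → B :* :1 :* (q :* c∞) := ((:0 :+ :0) :* K :+ :- :0 :* K :+ c∞) :* (B :* :1 :* q))
         refl c∞ (fromℕ k) (pow c∞ k) (binom k k))

    interior : ∀ k m → let n = k Nat.+ suc m in
      F (suc n) (suc k) (suc m) ≈ (- 0# * fromℕ n + 0# * fromℕ (suc k) + c0) * F n (suc k) m
                                  + ((0# + 0#) * fromℕ n + - 0# * fromℕ k + c∞) * F n k (suc m)
    interior k m = trans (*-congʳ (*-congʳ (binom-pascal n k)))
      (solve 8 (λ c0 c∞ N K p q B₀ B₁ →
          (B₀ :+ B₁) :* (p :* c0) :* (q :* c∞)
        := (:- :0 :* N :+ :0 :* (:1 :+ K) :+ c0) :* (B₁ :* p :* (q :* c∞))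
           :+ ((:0 :+ :0) :* N :+ :- :0 :* K :+ c∞) :* (B₀ :* (p :* c0) :* q))
         refl c0 c∞ (fromℕ n) (fromℕ k) (pow c0 m) (pow c∞ k) (binom n k) (binom n (suc k)))
      where n = k Nat.+ suc m

  E[-1,1]-closed-form : ∀ c0 c∞ {n k} → k ≤ n →
    E (- 1#) 1# c0 c∞ n k ≈ binom n k * rise (c0 + fromℕ k) (n ∸ k) * fall c∞ k
  E[-1,1]-closed-form c0 c∞ = GKP-unique (- - 1#) 1# c0 (- 1# + 1#) (- 1#) c∞ F init column diagonal interior
    where
    F : ℕ → ℕ → ℕ → Carrier
    F n k m = binom n k * rise (c0 + fromℕ k) m * fall c∞ k

    init : F 0 0 0 ≈ 1#
    init = solve 0 ((:1 :+ :0) :* :1 :* :1 := :1) refl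

    column : ∀ m → F (suc m) 0 (suc m) ≈ (- - 1# * fromℕ m + c0) * F m 0 m
    column m = solve 3 (λ c0 M r → (:1 :+ :0) :* (r :* (c0 :+ :0 :+ M)) :* :1
                                 := (:- :- :1 :* M :+ c0) :* ((:1 :+ :0) :* r :* :1))
                 refl c0 (fromℕ m) (rise (c0 + 0#) m)

    diagonal : ∀ k → F (suc k) (suc k) 0 ≈ ((- 1# + 1#) * fromℕ k + - 1# * fromℕ k + c∞) * F k k 0
    diagonal k = trans (*-congʳ (*-congʳ (trans (binom-diagonal (suc k)) (sym (binom-diagonal k)))))
      (solve 4 (λ c∞ K f B → B :* :1 :* (f :* (c∞ :- K))
                           := ((:- :1 :+ :1) :* K :+ :- :1 :* K :+ c∞) :* (B :* :1 :* f))
         refl c∞ (fromℕ k) (fall c∞ k) (binom k k))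

    interior : ∀ k m → let n = k Nat.+ suc m in
      F (suc n) (suc k) (suc m) ≈ (- - 1# * fromℕ n + 1# * fromℕ (suc k) + c0) * F n (suc k) m
                                  + ((- 1# + 1#) * fromℕ n + - 1# * fromℕ k + c∞) * F n k (suc m)
    interior k m =
      ≈-modulo (≈-modulo (≈-modulo
        (trans (*-congʳ (*-congʳ (binom-pascal n k)))
               (polynomial-identity c0 c∞ (fromℕ n) K (fromℕ m) (fall c∞ k) r (rise (c0 + K) (suc m))
                                    (binom n k) (binom n (suc k))))
        rise-shift′) (binom-absorption n k)) (fromℕ-+ k (suc m))
      where
      n = k Nat.+ suc m
      K = fromℕ k
      r = rise (c0 + (1# + K)) m
      rise-shift′ : rise (c0 + K) (suc m) ≈ (c0 + K) * r
      rise-shift′ = trans (rise-shift (c0 + K) m)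
                          (*-congˡ (rise-cong m (trans (+-assoc c0 K 1#) (+-congˡ (+-comm K 1#)))))
      polynomial-identity : ∀ c0 c∞ N K M f r r′ B₀ B₁ →
        (B₀ + B₁) * (r * (c0 + (1# + K) + M)) * (f * (c∞ - K))
        ≈ (- - 1# * N + 1# * (1# + K) + c0) * (B₁ * r * (f * (c∞ - K)))
          + ((- 1# + 1#) * N + - 1# * K + c∞) * (B₀ * r′ * f)
          + - (r * f * (c∞ - K) * (B₀ + B₁)) * (N - (K + (1# + M)))
          + - (r * f * (c∞ - K)) * ((1# + K) * B₁ + K * B₀ - N * B₀)
          + - (((- 1# + 1#) * N + - 1# * K + c∞) * B₀ * f) * (r′ - (c0 + K) * r)
      polynomial-identity = solve 10 (λ c0 c∞ N K M f r r′ B₀ B₁ →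
          (B₀ :+ B₁) :* (r :* (c0 :+ (:1 :+ K) :+ M)) :* (f :* (c∞ :- K))
        := (:- :- :1 :* N :+ :1 :* (:1 :+ K) :+ c0) :* (B₁ :* r :* (f :* (c∞ :- K)))
           :+ ((:- :1 :+ :1) :* N :+ :- :1 :* K :+ c∞) :* (B₀ :* r′ :* f)
           :+ :- (r :* f :* (c∞ :- K) :* (B₀ :+ B₁)) :* (N :- (K :+ (:1 :+ M)))
           :+ :- (r :* f :* (c∞ :- K)) :* ((:1 :+ K) :* B₁ :+ K :* B₀ :- N :* B₀)
           :+ :- (((:- :1 :+ :1) :* N :+ :- :1 :* K :+ c∞) :* B₀ :* f) :* (r′ :- (c0 :+ K) :* r)) refl

  E[c∞=-c0]-closed-form : ∀ a b c0 {n k} → k ≤ n →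
    E a b c0 (- c0) n k ≈ pow (- 1#) k * binom n k * gfall c0 n a
  E[c∞=-c0]-closed-form a b c0 = GKP-unique (- a) b c0 (a + b) (- b) (- c0) F init column diagonal interior
    where
    F : ℕ → ℕ → ℕ → Carrier
    F n k _ = pow (- 1#) k * binom n k * gfall c0 n a

    init : F 0 0 0 ≈ 1#
    init = solve 0 (:1 :* (:1 :+ :0) :* :1 := :1) refl

    column : ∀ m → F (suc m) 0 (suc m) ≈ (- a * fromℕ m + c0) * F m 0 m
    column m = solve 4 (λ a c0 M g → :1 :* (:1 :+ :0) :* (g :* (c0 :- M :* a))
                                   := (:- a :* M :+ c0) :* (:1 :* (:1 :+ :0) :* g))
                 refl a c0 (fromℕ m) (gfall c0 m a)

    diagonal : ∀ k → F (suc k) (suc k) 0 ≈ ((a + b) * fromℕ k + - b * fromℕ k + - c0) * F k k 0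
    diagonal k = trans (*-congʳ (*-congˡ (trans (binom-diagonal (suc k)) (sym (binom-diagonal k)))))
      (solve 7 (λ a b c0 K s g B → s :* :- :1 :* B :* (g :* (c0 :- K :* a))
                                 := ((a :+ b) :* K :+ :- b :* K :+ :- c0) :* (s :* B :* g))
         refl a b c0 (fromℕ k) (pow (- 1#) k) (gfall c0 k a) (binom k k))

    interior : ∀ k m → let n = k Nat.+ suc m in
      F (suc n) (suc k) (suc m) ≈ (- a * fromℕ n + b * fromℕ (suc k) + c0) * F n (suc k) m
                                  + ((a + b) * fromℕ n + - b * fromℕ k + - c0) * F n k (suc m)
    interior k m = ≈-modulo (trans (*-congʳ (*-congˡ (binom-pascal n k)))
      (solve 9 (λ a b c0 s g N K B₀ B₁ →
          s :* :- :1 :* (B₀ :+ B₁) :* (g :* (c0 :- N :* a))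
        := (:- a :* N :+ b :* (:1 :+ K) :+ c0) :* (s :* :- :1 :* B₁ :* g)
           :+ ((a :+ b) :* N :+ :- b :* K :+ :- c0) :* (s :* B₀ :* g)
           :+ (s :* g :* b) :* ((:1 :+ K) :* B₁ :+ K :* B₀ :- N :* B₀))
         refl a b c0 (pow (- 1#) k) (gfall c0 n a) (fromℕ n) (fromℕ k) (binom n k) (binom n (suc k))))
      (binom-absorption n k)
      where n = k Nat.+ suc m

theorem4p16 : ∀ {c ℓ} (R : CommutativeRing c ℓ) →
    let open CommutativeRing R
        open GKPDefs R
    in
    ∀ (c0 c∞ : Carrier) (n k : ℕ) → k ≤ n →
      (E 0# 0# c0 c∞ n k ≈ binom n k * pow c0 (n ∸ k) * pow c∞ k)
      × (E (- 1#) 1# c0 c∞ n k ≈ binom n k * rise (c0 + fromℕ k) (n ∸ k) * fall c∞ k)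
      × (∀ (a b : Carrier) → E a b c0 (- c0) n k ≈ pow (- 1#) k * binom n k * gfall c0 n a)
theorem4p16 R c0 c∞ n k k≤n =
    E[0,0]-closed-form R c0 c∞ k≤n
  , E[-1,1]-closed-form R c0 c∞ k≤n
  , λ a b → E[c∞=-c0]-closed-form R a b c0 k≤n
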